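{- For the crown graph $H_{n,n}$ with $n\geq 3$, $SPC_{2U}(H_{n,n})=2$.
   Context: The crown graph $H_{n,n}$ has vertex set $\{a_0,\dots,a_{n-1},b_0,\dots,b_{n-1}\}$, with $a_i$ adjacent to $b_j$ iff $i\neq j$, and no other edges. For a graph $G$ with distance $d$, a set $S\subseteq V(G)$ is a $2$-shortest path union cover if every edge of $G$ lies on some shortest $u$–$v$ path with $u\in S$ and $d(u,v)\leq 2$; $SPC_{2U}(G)$ is the minimum cardinality of such a set. -}

module Defs where

open import Data.Nat using (ℕ; zero; suc; _+_; _≤_; _<_)
open import Data.Fin using (Fin; splitAt)
open import Data.Fin.Subset using (Subset; _∈_; ∣_∣)
open import Data.Sum using (_⊎_; inj₁; inj₂)
open import Data.Product using (Σ; ∃; ∃-syntax; _×_; _,_)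
open import Data.Empty using (⊥)
open import Data.Unit using (⊤)
open import Relation.Binary.PropositionalEquality using (_≡_)
open import Relation.Nullary using (¬_)

record Graph (m : ℕ) : Set₁ where
  field
    Adj : Fin m → Fin m → Set

open Graph public

data Walk {m} (G : Graph m) : Fin m → Fin m → ℕ → Set where
  [] : ∀ {u} → Walk G u u 0
  _∷_ : ∀ {u w v k} → Adj G u w → Walk G w v k → Walk G u v (suc k)

-- The (undirected) edge {x , y} is traversed by the walk.
data OnWalk {m} {G : Graph m} (x y : Fin m) :
       ∀ {u v k} → Walk G u v k → Set where
  here⃗ : ∀ {w v k} (e : Adj G x w) (p : Walk G w v k) →
         w ≡ y → OnWalk x y (e ∷ p)
  here⃖ : ∀ {u w v k} (e : Adj G u w) (p : Walk G w v k) →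
         u ≡ y → w ≡ x → OnWalk x y (e ∷ p)
  there : ∀ {u w v k} (e : Adj G u w) (p : Walk G w v k) →
          OnWalk x y p → OnWalk x y (e ∷ p)

IsShortest : ∀ {m} {G : Graph m} {u v k} → Walk G u v k → Set
IsShortest {G = G} {u} {v} {k} _ = ∀ {j} → Walk G u v j → k ≤ j

IsSPC2UCover : ∀ {m} → Graph m → Subset m → Set
IsSPC2UCover {m} G S =
  ∀ (x y : Fin m) → Adj G x y →
    ∃[ u ] ∃[ v ] ∃[ k ] Σ (Walk G u v k) λ p →
      u ∈ S × k ≤ 2 × IsShortest p × OnWalk x y p

SPC2U≡ : ∀ {m} → Graph m → ℕ → Set
SPC2U≡ {m} G c =
  (∃[ S ] (IsSPC2UCover G S × ∣ S ∣ ≡ c)) ×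
  (∀ (S : Subset m) → IsSPC2UCover G S → c ≤ ∣ S ∣)

-- Vertices of H_{n,n}: Fin (n + n); index i < n is a_i, index n + j is b_j.
CrownAdj' : ∀ {n} → Fin n ⊎ Fin n → Fin n ⊎ Fin n → Set
CrownAdj' (inj₁ i) (inj₂ j) = ¬ (i ≡ j)
CrownAdj' (inj₂ j) (inj₁ i) = ¬ (i ≡ j)
CrownAdj' (inj₁ _) (inj₁ _) = ⊥
CrownAdj' (inj₂ _) (inj₂ _) = ⊥

Crown : (n : ℕ) → Graph (n + n)
Crown n = record { Adj = λ x y → CrownAdj' (splitAt n x) (splitAt n y) }

-- A walk of length at most 2 starting at u only traverses edges with an endpoint in the
-- closed neighbourhood of u.  In H_{n,n} (n ≥ 2) every vertex misses some edge:
-- a_k misses a_{k'} b_k and b_k misses a_k b_{k'} for k' ≠ k.  Hence no single vertex is a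
-- cover, while {a₀, b₀} is one: a₀ and b₀ cover the edges at them, and any other edge
-- a_i b_j lies on the geodesic a₀ b_j a_i.
module Submission where

open import Defs
open import Data.Nat using (ℕ; zero; suc; _+_; _≤_; z≤n; s≤s)
open import Data.Nat.Properties using (≤-trans; ≤-reflexive; ≤-antisym; +-suc; +-monoʳ-≤; n≤1+n)
open import Data.Fin using (Fin; zero; suc; splitAt; join; _↑ˡ_; _↑ʳ_)
open import Data.Fin.Properties
  using (splitAt-↑ˡ; splitAt-↑ʳ; join-splitAt; ↑ˡ-injective; ↑ʳ-injective)
open import Data.Fin.Subset using (Subset; _∈_; ∣_∣; _∪_; ⁅_⁆; inside; outside)
open import Data.Fin.Subset.Properties
  using (x∈p⇒∣p-x∣<∣p∣; x∈p∧x≢y⇒x∈p-y; x∈⁅x⁆; p⊆p∪q; q⊆p∪q; ∣⁅x⁆∣≡1)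
open import Data.Vec using ([]; _∷_)
open import Data.Sum using (_⊎_; inj₁; inj₂; [_,_]′)
open import Data.Product using (Σ; ∃-syntax; _×_; _,_)
open import Data.Empty using (⊥-elim)
open import Function using (_∘_)
open import Relation.Binary.PropositionalEquality
  using (_≡_; _≢_; refl; sym; trans; cong; subst; subst₂)
open import Relation.Nullary using (¬_)

∣p∪q∣≤∣p∣+∣q∣ : ∀ {m} (p q : Subset m) → ∣ p ∪ q ∣ ≤ ∣ p ∣ + ∣ q ∣
∣p∪q∣≤∣p∣+∣q∣ []            []            = z≤n
∣p∪q∣≤∣p∣+∣q∣ (inside ∷ p)  (outside ∷ q) = s≤s (∣p∪q∣≤∣p∣+∣q∣ p q)
∣p∪q∣≤∣p∣+∣q∣ (inside ∷ p)  (inside ∷ q)  =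
  s≤s (≤-trans (∣p∪q∣≤∣p∣+∣q∣ p q) (+-monoʳ-≤ ∣ p ∣ (n≤1+n ∣ q ∣)))
∣p∪q∣≤∣p∣+∣q∣ (outside ∷ p) (inside ∷ q)  =
  ≤-trans (s≤s (∣p∪q∣≤∣p∣+∣q∣ p q)) (≤-reflexive (sym (+-suc ∣ p ∣ ∣ q ∣)))
∣p∪q∣≤∣p∣+∣q∣ (outside ∷ p) (outside ∷ q) = ∣p∪q∣≤∣p∣+∣q∣ p q

x∈p∧y∈p∧x≢y⇒2≤∣p∣ : ∀ {m} {p : Subset m} {x y} → x ∈ p → y ∈ p → x ≢ y → 2 ≤ ∣ p ∣
x∈p∧y∈p∧x≢y⇒2≤∣p∣ x∈p y∈p x≢y =
  ≤-trans (s≤s (x∈p⇒1≤∣p∣ (x∈p∧x≢y⇒x∈p-y y∈p (x≢y ∘ sym)))) (x∈p⇒∣p-x∣<∣p∣ x∈p)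
  where
  x∈p⇒1≤∣p∣ : ∀ {m} {p : Subset m} {x} → x ∈ p → 1 ≤ ∣ p ∣
  x∈p⇒1≤∣p∣ x∈p = ≤-trans (s≤s z≤n) (x∈p⇒∣p-x∣<∣p∣ x∈p)

module _ {m} {G : Graph m} where

  Near : Fin m → Fin m → Set
  Near u x = u ≡ x ⊎ Adj G u x

  CoveredBy : Subset m → Fin m → Fin m → Set
  CoveredBy S x y = ∃[ u ] ∃[ v ] ∃[ k ] Σ (Walk G u v k) λ p →
    u ∈ S × k ≤ 2 × IsShortest p × OnWalk x y p

  FarEdge : Fin m → Set
  FarEdge u = ∃[ x ] ∃[ y ] Adj G x y × ¬ Near u x × ¬ Near u y

  onWalk-sym : ∀ {x y u v k} {p : Walk G u v k} → OnWalk x y p → OnWalk y x p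
  onWalk-sym (here⃗ e p refl)      = here⃖ e p refl refl
  onWalk-sym (here⃖ e p refl refl) = here⃗ e p refl
  onWalk-sym (there e p o)         = there e p (onWalk-sym o)

  coveredBy-sym : ∀ {S x y} → CoveredBy S x y → CoveredBy S y x
  coveredBy-sym (u , v , k , p , u∈S , k≤2 , p-shortest , xy∈p) =
    u , v , k , p , u∈S , k≤2 , p-shortest , onWalk-sym xy∈p

  onShortWalk⇒near : ∀ {x y u v k} (p : Walk G u v k) → k ≤ 2 →
                     OnWalk x y p → Near u x ⊎ Near u y
  onShortWalk⇒near (e ∷ p)       _ (here⃗ .e .p _)        = inj₁ (inj₁ refl)
  onShortWalk⇒near (e ∷ p)       _ (here⃖ .e .p refl _)   = inj₂ (inj₁ refl)
  onShortWalk⇒near (e ∷ e′ ∷ p)  _ (there .e _ (here⃗ .e′ .p _))      = inj₁ (inj₂ e)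
  onShortWalk⇒near (e ∷ e′ ∷ p)  _ (there .e _ (here⃖ .e′ .p refl _)) = inj₂ (inj₂ e)
  onShortWalk⇒near (e ∷ e′ ∷ e″ ∷ p) (s≤s (s≤s ())) (there .e _ (there .e′ _ _))

  coveredBy-farFrom⇒other : ∀ {S u x y} → ¬ Near u x → ¬ Near u y → CoveredBy S x y →
                            ∃[ u′ ] u′ ∈ S × u′ ≢ u
  coveredBy-farFrom⇒other ¬u≈x ¬u≈y (u′ , _ , _ , p , u′∈S , k≤2 , _ , xy∈p) =
    u′ , u′∈S , λ { refl → [ ¬u≈x , ¬u≈y ]′ (onShortWalk⇒near p k≤2 xy∈p) }

  farEdges⇒2≤∣cover∣ : (∀ u → FarEdge u) → ∀ x y → Adj G x y →
                       ∀ {S} → IsSPC2UCover G S → 2 ≤ ∣ S ∣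
  farEdges⇒2≤∣cover∣ far x y x~y cover
    with u , _ , _ , _ , u∈S , _ ← cover x y x~y
    with x′ , y′ , x′~y′ , ¬u≈x′ , ¬u≈y′ ← far u
    with u′ , u′∈S , u′≢u ← coveredBy-farFrom⇒other ¬u≈x′ ¬u≈y′ (cover x′ y′ x′~y′)
    = x∈p∧y∈p∧x≢y⇒2≤∣p∣ u′∈S u∈S u′≢u

  edge-isShortest : ∀ {u v} → u ≢ v → (e : Adj G u v) → IsShortest {G = G} (e ∷ [])
  edge-isShortest u≢v _ {zero}  [] = ⊥-elim (u≢v refl)
  edge-isShortest u≢v _ {suc _} _  = s≤s z≤n

  path₂-isShortest : ∀ {u v} → u ≢ v → ¬ Adj G u v → (p : Walk G u v 2) → IsShortest p
  path₂-isShortest u≢v ¬u~v _ {zero}        []       = ⊥-elim (u≢v refl)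
  path₂-isShortest u≢v ¬u~v _ {suc zero}    (e ∷ []) = ⊥-elim (¬u~v e)
  path₂-isShortest u≢v ¬u~v _ {suc (suc _)} _        = s≤s (s≤s z≤n)

module CrownVertices (n : ℕ) where

  a b : Fin n → Fin (n + n)
  a i = i ↑ˡ n
  b j = n ↑ʳ j

  data Side : Fin (n + n) → Set where
    inA : ∀ i → Side (a i)
    inB : ∀ j → Side (b j)

  side : ∀ x → Side x
  side x = subst Side (join-splitAt n n x) (sideOf (splitAt n x))
    where
    sideOf : ∀ s → Side (join n n s)
    sideOf (inj₁ i) = inA i
    sideOf (inj₂ j) = inB j

  a≢b : ∀ {i j} → a i ≢ b j
  a≢b {i} {j} eq
    with () ← trans (sym (splitAt-↑ˡ n i n)) (trans (cong (splitAt n) eq) (splitAt-↑ʳ n n j))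

  a-injective : ∀ {i j} → a i ≡ a j → i ≡ j
  a-injective = ↑ˡ-injective n _ _

  b-injective : ∀ {i j} → b i ≡ b j → i ≡ j
  b-injective = ↑ʳ-injective n _ _

  a~b⇒≢ : ∀ i j → Adj (Crown n) (a i) (b j) → i ≢ j
  a~b⇒≢ i j = subst₂ CrownAdj' (splitAt-↑ˡ n i n) (splitAt-↑ʳ n n j)

  ≢⇒a~b : ∀ i j → i ≢ j → Adj (Crown n) (a i) (b j)
  ≢⇒a~b i j = subst₂ CrownAdj' (sym (splitAt-↑ˡ n i n)) (sym (splitAt-↑ʳ n n j))

  b~a⇒≢ : ∀ i j → Adj (Crown n) (b j) (a i) → i ≢ j
  b~a⇒≢ i j = subst₂ CrownAdj' (splitAt-↑ʳ n n j) (splitAt-↑ˡ n i n)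

  ¬a~a : ∀ i j → ¬ Adj (Crown n) (a i) (a j)
  ¬a~a i j = subst₂ CrownAdj' (splitAt-↑ˡ n i n) (splitAt-↑ˡ n j n)

  ¬b~b : ∀ i j → ¬ Adj (Crown n) (b i) (b j)
  ¬b~b i j = subst₂ CrownAdj' (splitAt-↑ʳ n n i) (splitAt-↑ʳ n n j)

  crown-sym : ∀ x y → Adj (Crown n) x y → Adj (Crown n) y x
  crown-sym x y = CrownAdj'-sym (splitAt n x) (splitAt n y)
    where
    CrownAdj'-sym : ∀ s t → CrownAdj' s t → CrownAdj' t s
    CrownAdj'-sym (inj₁ _) (inj₂ _) i≢j = i≢j
    CrownAdj'-sym (inj₂ _) (inj₁ _) i≢j = i≢j

module _ {m : ℕ} where
  open CrownVertices (suc (suc m))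

  other : Fin (suc (suc m)) → Fin (suc (suc m))
  other zero    = suc zero
  other (suc _) = zero

  other≢ : ∀ k → other k ≢ k
  other≢ zero    ()
  other≢ (suc _) ()

  crown-farEdge : ∀ u → FarEdge {G = Crown (suc (suc m))} u
  crown-farEdge u with side u
  ... | inA k = a (other k) , b k , ≢⇒a~b _ _ (other≢ k) ,
                [ other≢ k ∘ sym ∘ a-injective , ¬a~a k (other k) ]′ ,
                [ a≢b , (λ a~b → a~b⇒≢ k k a~b refl) ]′
  ... | inB k = a k , b (other k) , ≢⇒a~b _ _ (other≢ k ∘ sym) ,
                [ a≢b ∘ sym , (λ b~a → b~a⇒≢ k k b~a refl) ]′ ,
                [ other≢ k ∘ sym ∘ b-injective , ¬b~b k (other k) ]′

module _ {m : ℕ} where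
  open CrownVertices (suc m)

  a₀b₀ : Subset (suc m + suc m)
  a₀b₀ = ⁅ a zero ⁆ ∪ ⁅ b zero ⁆

  a₀∈a₀b₀ : a zero ∈ a₀b₀
  a₀∈a₀b₀ = p⊆p∪q ⁅ b zero ⁆ (x∈⁅x⁆ (a zero))

  b₀∈a₀b₀ : b zero ∈ a₀b₀
  b₀∈a₀b₀ = q⊆p∪q ⁅ a zero ⁆ ⁅ b zero ⁆ (x∈⁅x⁆ (b zero))

  ∣a₀b₀∣≤2 : ∣ a₀b₀ ∣ ≤ 2
  ∣a₀b₀∣≤2 = subst₂ (λ k l → ∣ a₀b₀ ∣ ≤ k + l) (∣⁅x⁆∣≡1 (a zero)) (∣⁅x⁆∣≡1 (b zero))
                    (∣p∪q∣≤∣p∣+∣q∣ ⁅ a zero ⁆ ⁅ b zero ⁆)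

  a-b-coveredBy-a₀b₀ : ∀ i j → Adj (Crown (suc m)) (a i) (b j) →
                       CoveredBy {G = Crown (suc m)} a₀b₀ (a i) (b j)
  a-b-coveredBy-a₀b₀ zero    j       a~b =
    a zero , b j , 1 , a~b ∷ [] , a₀∈a₀b₀ , s≤s z≤n ,
    edge-isShortest a≢b a~b , here⃗ a~b [] refl
  a-b-coveredBy-a₀b₀ (suc i) zero    a~b =
    b zero , a (suc i) , 1 , b~a ∷ [] , b₀∈a₀b₀ , s≤s z≤n ,
    edge-isShortest (a≢b ∘ sym) b~a , here⃖ b~a [] refl refl
    where b~a = crown-sym (a (suc i)) (b zero) a~b
  a-b-coveredBy-a₀b₀ (suc i) (suc j) a~b =
    a zero , a (suc i) , 2 , a₀bⱼaᵢ , a₀∈a₀b₀ , s≤s (s≤s z≤n) ,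
    path₂-isShortest (λ ()) (¬a~a zero (suc i)) a₀bⱼaᵢ ,
    there a₀~bⱼ _ (here⃖ b~a [] refl refl)
    where
    b~a = crown-sym (a (suc i)) (b (suc j)) a~b
    a₀~bⱼ = ≢⇒a~b zero (suc j) λ ()
    a₀bⱼaᵢ = a₀~bⱼ ∷ b~a ∷ []

  a₀b₀-covers : IsSPC2UCover (Crown (suc m)) a₀b₀
  a₀b₀-covers x y x~y with side x | side y
  ... | inA i | inB j = a-b-coveredBy-a₀b₀ i j x~y
  ... | inB j | inA i = coveredBy-sym (a-b-coveredBy-a₀b₀ i j (crown-sym x y x~y))
  ... | inA i | inA j = ⊥-elim (¬a~a i j x~y)
  ... | inB i | inB j = ⊥-elim (¬b~b i j x~y)

crown-2≤∣cover∣ : ∀ m {S} → IsSPC2UCover (Crown (suc (suc m))) S → 2 ≤ ∣ S ∣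
crown-2≤∣cover∣ m =
  farEdges⇒2≤∣cover∣ {G = Crown (suc (suc m))} crown-farEdge
    (a zero) (b (suc zero)) (≢⇒a~b zero (suc zero) λ ())
  where open CrownVertices (suc (suc m))

spc2U-crown≡2 : ∀ m → SPC2U≡ (Crown (suc (suc m))) 2
spc2U-crown≡2 m =
  (a₀b₀ {suc m} , a₀b₀-covers , ≤-antisym (∣a₀b₀∣≤2 {suc m}) (crown-2≤∣cover∣ m a₀b₀-covers)) ,
  λ _ → crown-2≤∣cover∣ m

mainTheorem20 : (n : ℕ) → 3 ≤ n → SPC2U≡ (Crown n) 2
mainTheorem20 (suc (suc m)) (s≤s (s≤s _)) = spc2U-crown≡2 m
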